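{- The 2-endofunctor $\mathrm{Inv}$ of $\mathbf{SMCat}$ preserves linear-non-linear adjunctions: if $(L,l,t)\dashv(M,m,u)$ is a linear-non-linear adjunction between $(\mathcal M,\times,T)$ and $(\mathcal L,\otimes,1)$, then $\mathrm{Inv}(L,l,t)\dashv\mathrm{Inv}(M,m,u)$ is a linear-non-linear adjunction between $\mathrm{Inv}(\mathcal M)$ and $\mathrm{Inv}(\mathcal L)$.
   Context: $\mathbf{SMCat}$ is the 2-category of symmetric monoidal categories, (lax) symmetric monoidal functors and monoidal natural transformations. A linear-non-linear adjunction is a symmetric monoidal adjunction (an adjunction in $\mathbf{SMCat}$) $(L,l,t)\dashv(M,m,u)$ between symmetric monoidal functors $L:\mathcal M\to\mathcal L$, $M:\mathcal L\to\mathcal M$ such that $(\mathcal M,\times,T)$ is Cartesian (with $T$ terminal). For a category $\mathcal A$, $\mathrm{Inv}(\mathcal A)$ is the category whose objects are pairs $(A,s)$, $A$ an object of $\mathcal A$ and $s=(s_k)_{k\in\mathbb Z}$ a sequence of automorphisms of $A$ with $s_k\circ s_k=id_A$, and whose morphisms $(A,s)\to(B,t)$ are arrows $f:A\to B$ with $t_k\circ f\circ s_k=f$ for all $k$. On a symmetric monoidal category $(\mathcal A,\otimes,1)$, $\mathrm{Inv}$ gives the symmetric monoidal category with $(A,s)\otimes'(B,t)=(A\otimes B,(s_k\otimes t_k)_k)$, unit $(1,(id_1)_k)$ and structural isomorphisms those of $\mathcal A$. On a symmetric monoidal functor $(F,m,u)$, $\mathrm{Inv}(F,m,u)=(\mathrm{Inv}F,m',u')$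 with $\mathrm{Inv}F(A,s)=(FA,(F s_k)_k)$, $\mathrm{Inv}F(f)=Ff$, $m'_{(A,s),(A',s')}=m_{A,A'}$ and $u'=u$. On a monoidal natural transformation $\varphi$, $(\mathrm{Inv}\varphi)_{(A,s)}=\varphi_A$. -}

module Defs where

open import Level using (Level; _⊔_) renaming (suc to lsuc)
open import Data.Integer using (ℤ)
open import Data.Product using (Σ; _,_; _×_; proj₁; proj₂)
open import Relation.Binary using (IsEquivalence; Setoid)
import Relation.Binary.Reasoning.Setoid as SetoidR

record Category (o ℓ e : Level) : Set (lsuc (o ⊔ ℓ ⊔ e)) where
  infix 4 _≈_ _⇒_
  infixr 9 _∘_
  field
    Obj : Set o
    _⇒_ : Obj → Obj → Set ℓ
    _≈_ : ∀ {A B} → A ⇒ B → A ⇒ B → Set e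
    ≈-equiv : ∀ {A B} → IsEquivalence (_≈_ {A} {B})
    id : ∀ {A} → A ⇒ A
    _∘_ : ∀ {A B C} → B ⇒ C → A ⇒ B → A ⇒ C
    assoc : ∀ {A B C D} {f : A ⇒ B} {g : B ⇒ C} {h : C ⇒ D} →
            (h ∘ g) ∘ f ≈ h ∘ (g ∘ f)
    identityˡ : ∀ {A B} {f : A ⇒ B} → id ∘ f ≈ f
    identityʳ : ∀ {A B} {f : A ⇒ B} → f ∘ id ≈ f
    ∘-resp-≈ : ∀ {A B C} {f h : B ⇒ C} {g i : A ⇒ B} →
               f ≈ h → g ≈ i → f ∘ g ≈ h ∘ i

  hom-setoid : ∀ {A B} → Setoid ℓ e
  hom-setoid {A} {B} = record { Carrier = A ⇒ B ; _≈_ = _≈_ ; isEquivalence = ≈-equiv }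

  module HomReasoning {A B : Obj} = SetoidR (hom-setoid {A} {B})

  refl≈ : ∀ {A B} {f : A ⇒ B} → f ≈ f
  refl≈ = IsEquivalence.refl ≈-equiv
  sym≈ : ∀ {A B} {f g : A ⇒ B} → f ≈ g → g ≈ f
  sym≈ = IsEquivalence.sym ≈-equiv
  trans≈ : ∀ {A B} {f g h : A ⇒ B} → f ≈ g → g ≈ h → f ≈ h
  trans≈ = IsEquivalence.trans ≈-equiv

  inverse-square : ∀ {A B} {to : A ⇒ B} {from : B ⇒ A} {x : A ⇒ A} {y : B ⇒ B} →
    from ∘ to ≈ id → to ∘ from ≈ id → to ∘ x ≈ y ∘ to → x ∘ from ≈ from ∘ y
  inverse-square {to = to} {from} {x} {y} ft tf sq = begin
      x ∘ from                   ≈⟨ sym≈ identityˡ ⟩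
      id ∘ (x ∘ from)            ≈⟨ ∘-resp-≈ (sym≈ ft) refl≈ ⟩
      (from ∘ to) ∘ (x ∘ from)   ≈⟨ assoc ⟩
      from ∘ (to ∘ (x ∘ from))   ≈⟨ ∘-resp-≈ refl≈ (sym≈ assoc) ⟩
      from ∘ ((to ∘ x) ∘ from)   ≈⟨ ∘-resp-≈ refl≈ (∘-resp-≈ sq refl≈) ⟩
      from ∘ ((y ∘ to) ∘ from)   ≈⟨ ∘-resp-≈ refl≈ assoc ⟩
      from ∘ (y ∘ (to ∘ from))   ≈⟨ ∘-resp-≈ refl≈ (∘-resp-≈ refl≈ tf) ⟩
      from ∘ (y ∘ id)            ≈⟨ ∘-resp-≈ refl≈ identityʳ ⟩
      from ∘ y                   ∎
    where open HomReasoning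

record SymMonCat (o ℓ e : Level) : Set (lsuc (o ⊔ ℓ ⊔ e)) where
  field
    cat : Category o ℓ e
  open Category cat public
  infixr 10 _⊗₀_ _⊗₁_
  field
    _⊗₀_ : Obj → Obj → Obj
    _⊗₁_ : ∀ {A B C D} → A ⇒ B → C ⇒ D → A ⊗₀ C ⇒ B ⊗₀ D
    ⊗-identity : ∀ {A B} → id {A} ⊗₁ id {B} ≈ id
    ⊗-homomorphism : ∀ {A B C D E F} {f : A ⇒ B} {g : B ⇒ C} {h : D ⇒ E} {i : E ⇒ F} →
                     (g ∘ f) ⊗₁ (i ∘ h) ≈ (g ⊗₁ i) ∘ (f ⊗₁ h)
    ⊗-resp-≈ : ∀ {A B C D} {f g : A ⇒ B} {h i : C ⇒ D} →
               f ≈ g → h ≈ i → f ⊗₁ h ≈ g ⊗₁ i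
    unit : Obj
    α⇒ : ∀ {A B C} → (A ⊗₀ B) ⊗₀ C ⇒ A ⊗₀ (B ⊗₀ C)
    α⇐ : ∀ {A B C} → A ⊗₀ (B ⊗₀ C) ⇒ (A ⊗₀ B) ⊗₀ C
    α-isoˡ : ∀ {A B C} → α⇐ ∘ α⇒ {A} {B} {C} ≈ id
    α-isoʳ : ∀ {A B C} → α⇒ ∘ α⇐ {A} {B} {C} ≈ id
    α-natural : ∀ {A A' B B' C C'} {f : A ⇒ A'} {g : B ⇒ B'} {h : C ⇒ C'} →
                α⇒ ∘ ((f ⊗₁ g) ⊗₁ h) ≈ (f ⊗₁ (g ⊗₁ h)) ∘ α⇒
    lu⇒ : ∀ {A} → unit ⊗₀ A ⇒ A
    lu⇐ : ∀ {A} → A ⇒ unit ⊗₀ A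
    lu-isoˡ : ∀ {A} → lu⇐ ∘ lu⇒ {A} ≈ id
    lu-isoʳ : ∀ {A} → lu⇒ ∘ lu⇐ {A} ≈ id
    lu-natural : ∀ {A B} {f : A ⇒ B} → lu⇒ ∘ (id ⊗₁ f) ≈ f ∘ lu⇒
    ru⇒ : ∀ {A} → A ⊗₀ unit ⇒ A
    ru⇐ : ∀ {A} → A ⇒ A ⊗₀ unit
    ru-isoˡ : ∀ {A} → ru⇐ ∘ ru⇒ {A} ≈ id
    ru-isoʳ : ∀ {A} → ru⇒ ∘ ru⇐ {A} ≈ id
    ru-natural : ∀ {A B} {f : A ⇒ B} → ru⇒ ∘ (f ⊗₁ id) ≈ f ∘ ru⇒
    σ : ∀ {A B} → A ⊗₀ B ⇒ B ⊗₀ A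
    σ-natural : ∀ {A A' B B'} {f : A ⇒ A'} {g : B ⇒ B'} →
                σ ∘ (f ⊗₁ g) ≈ (g ⊗₁ f) ∘ σ
    σ-involutive : ∀ {A B} → σ {B} {A} ∘ σ {A} {B} ≈ id
    pentagon : ∀ {A B C D} →
      (id {A} ⊗₁ α⇒ {B} {C} {D}) ∘ (α⇒ ∘ (α⇒ ⊗₁ id)) ≈ α⇒ ∘ α⇒
    triangle : ∀ {A B} → (id {A} ⊗₁ lu⇒ {B}) ∘ α⇒ ≈ ru⇒ ⊗₁ id
    hexagon : ∀ {A B C} →
      (id {B} ⊗₁ σ {A} {C}) ∘ (α⇒ ∘ (σ ⊗₁ id)) ≈ α⇒ ∘ (σ ∘ α⇒)

module _ {o ℓ e} (C : SymMonCat o ℓ e) where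
  open SymMonCat C

  IsTerminal : Obj → Set (o ⊔ ℓ ⊔ e)
  IsTerminal T = ∀ A → Σ (A ⇒ T) λ ! → ∀ (f : A ⇒ T) → f ≈ !

  IsProduct : ∀ {A B P} → P ⇒ A → P ⇒ B → Set (o ⊔ ℓ ⊔ e)
  IsProduct {A} {B} {P} π₁ π₂ =
    ∀ {X} (f : X ⇒ A) (g : X ⇒ B) →
      Σ (X ⇒ P) λ h → (π₁ ∘ h ≈ f) × (π₂ ∘ h ≈ g) ×
        (∀ (h' : X ⇒ P) → π₁ ∘ h' ≈ f → π₂ ∘ h' ≈ g → h' ≈ h)

  IsCartesian : Set (o ⊔ ℓ ⊔ e)
  IsCartesian = Σ (IsTerminal unit) λ term →
    ∀ A B → IsProduct {A} {B} {A ⊗₀ B}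
              (ru⇒ ∘ (id ⊗₁ proj₁ (term B)))
              (lu⇒ ∘ (proj₁ (term A) ⊗₁ id))

record LaxData {o ℓ e o' ℓ' e'} (C : SymMonCat o ℓ e) (D : SymMonCat o' ℓ' e')
       : Set (o ⊔ ℓ ⊔ o' ⊔ ℓ') where
  private
    module C = SymMonCat C
  open SymMonCat D
  field
    F₀ : C.Obj → Obj
    F₁ : ∀ {A B} → A C.⇒ B → F₀ A ⇒ F₀ B
    μ : ∀ {A B} → F₀ A ⊗₀ F₀ B ⇒ F₀ (A C.⊗₀ B)
    ε : unit ⇒ F₀ C.unit

record LaxSymMonFunctor {o ℓ e o' ℓ' e'} (C : SymMonCat o ℓ e) (D : SymMonCat o' ℓ' e')
       : Set (o ⊔ ℓ ⊔ e ⊔ o' ⊔ ℓ' ⊔ e') where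
  private
    module C = SymMonCat C
  open SymMonCat D
  field
    dat : LaxData C D
  open LaxData dat public
  field
    identity : ∀ {A} → F₁ (C.id {A}) ≈ id
    homomorphism : ∀ {A B X} {f : A C.⇒ B} {g : B C.⇒ X} → F₁ (g C.∘ f) ≈ F₁ g ∘ F₁ f
    F-resp-≈ : ∀ {A B} {f g : A C.⇒ B} → f C.≈ g → F₁ f ≈ F₁ g
    μ-natural : ∀ {A A' B B'} {f : A C.⇒ A'} {g : B C.⇒ B'} →
      μ ∘ (F₁ f ⊗₁ F₁ g) ≈ F₁ (f C.⊗₁ g) ∘ μ
    associativity : ∀ {A B X} →
      F₁ (C.α⇒ {A} {B} {X}) ∘ (μ ∘ (μ ⊗₁ id)) ≈ μ ∘ ((id ⊗₁ μ) ∘ α⇒)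
    unitaryˡ : ∀ {A} → F₁ (C.lu⇒ {A}) ∘ (μ ∘ (ε ⊗₁ id)) ≈ lu⇒
    unitaryʳ : ∀ {A} → F₁ (C.ru⇒ {A}) ∘ (μ ∘ (id ⊗₁ ε)) ≈ ru⇒
    braiding : ∀ {A B} → F₁ (C.σ {A} {B}) ∘ μ ≈ μ ∘ σ

-- identity and composite (structure data only; used to type unit/counit)
idData : ∀ {o ℓ e} (C : SymMonCat o ℓ e) → LaxData C C
idData C = record { F₀ = λ A → A ; F₁ = λ f → f ; μ = id ; ε = id }
  where open SymMonCat C

_∘Data_ : ∀ {o ℓ e o' ℓ' e' o'' ℓ'' e''}
  {C : SymMonCat o ℓ e} {D : SymMonCat o' ℓ' e'} {E : SymMonCat o'' ℓ'' e''} →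
  LaxData D E → LaxData C D → LaxData C E
_∘Data_ {E = E} G F = record
  { F₀ = λ A → G.F₀ (F.F₀ A)
  ; F₁ = λ f → G.F₁ (F.F₁ f)
  ; μ = G.F₁ F.μ ∘ G.μ
  ; ε = G.F₁ F.ε ∘ G.ε
  }
  where
    open SymMonCat E
    module G = LaxData G
    module F = LaxData F

record MonoidalNT {o ℓ e o' ℓ' e'} {C : SymMonCat o ℓ e} {D : SymMonCat o' ℓ' e'}
       (F G : LaxData C D) : Set (o ⊔ ℓ ⊔ ℓ' ⊔ e') where
  private
    module C = SymMonCat C
    module F = LaxData F
    module G = LaxData G
  open SymMonCat D
  field
    η : ∀ A → F.F₀ A ⇒ G.F₀ A
    natural : ∀ {A B} (f : A C.⇒ B) → η B ∘ F.F₁ f ≈ G.F₁ f ∘ η A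
    μ-compat : ∀ A B → η (A C.⊗₀ B) ∘ F.μ ≈ G.μ ∘ (η A ⊗₁ η B)
    ε-compat : η C.unit ∘ F.ε ≈ G.ε

record SymMonAdjunction {o ℓ e o' ℓ' e'} {C : SymMonCat o ℓ e} {D : SymMonCat o' ℓ' e'}
       (L : LaxSymMonFunctor C D) (R : LaxSymMonFunctor D C)
       : Set (o ⊔ ℓ ⊔ e ⊔ o' ⊔ ℓ' ⊔ e') where
  private
    module C = SymMonCat C
    module D = SymMonCat D
    module L = LaxSymMonFunctor L
    module R = LaxSymMonFunctor R
  field
    unitNT : MonoidalNT (idData C) (R.dat ∘Data L.dat)
    counitNT : MonoidalNT (L.dat ∘Data R.dat) (idData D)
  module η = MonoidalNT unitNT
  module ε = MonoidalNT counitNT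
  field
    zig : ∀ A → ε.η (L.F₀ A) D.∘ L.F₁ (η.η A) D.≈ D.id
    zag : ∀ B → R.F₁ (ε.η B) C.∘ η.η (R.F₀ B) C.≈ C.id

LNLAdjunction : ∀ {o ℓ e o' ℓ' e'} {C : SymMonCat o ℓ e} {D : SymMonCat o' ℓ' e'}
  (L : LaxSymMonFunctor C D) (R : LaxSymMonFunctor D C) → Set (o ⊔ ℓ ⊔ e ⊔ o' ⊔ ℓ' ⊔ e')
LNLAdjunction {C = C} L R = IsCartesian C × SymMonAdjunction L R

module _ {o ℓ e} (C : Category o ℓ e) where
  open Category C

  record InvObj : Set (o ⊔ ℓ ⊔ e) where
    constructor invObj
    field
      carrier : Obj
      inv : ℤ → carrier ⇒ carrier
      inv-invol : ∀ k → inv k ∘ inv k ≈ id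

  open InvObj

  record InvHom (X Y : InvObj) : Set (ℓ ⊔ e) where
    constructor invHom
    field
      arr : carrier X ⇒ carrier Y
      comm : ∀ k → inv Y k ∘ (arr ∘ inv X k) ≈ arr

  open InvHom

  square⇒comm : ∀ {X Y : InvObj} {f : carrier X ⇒ carrier Y} →
    (∀ k → inv Y k ∘ f ≈ f ∘ inv X k) → ∀ k → inv Y k ∘ (f ∘ inv X k) ≈ f
  square⇒comm {X} {Y} {f} sq k = begin
      inv Y k ∘ (f ∘ inv X k)   ≈⟨ sym≈ assoc ⟩
      (inv Y k ∘ f) ∘ inv X k   ≈⟨ ∘-resp-≈ (sq k) refl≈ ⟩
      (f ∘ inv X k) ∘ inv X k   ≈⟨ assoc ⟩
      f ∘ (inv X k ∘ inv X k)   ≈⟨ ∘-resp-≈ refl≈ (inv-invol X k) ⟩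
      f ∘ id                    ≈⟨ identityʳ ⟩
      f                         ∎
    where open HomReasoning

  comm⇒square : ∀ {X Y : InvObj} (f : InvHom X Y) → ∀ k →
    inv Y k ∘ arr f ≈ arr f ∘ inv X k
  comm⇒square {X} {Y} f k = begin
      inv Y k ∘ arr f                           ≈⟨ sym≈ identityʳ ⟩
      (inv Y k ∘ arr f) ∘ id                    ≈⟨ ∘-resp-≈ refl≈ (sym≈ (inv-invol X k)) ⟩
      (inv Y k ∘ arr f) ∘ (inv X k ∘ inv X k)   ≈⟨ sym≈ assoc ⟩
      ((inv Y k ∘ arr f) ∘ inv X k) ∘ inv X k   ≈⟨ ∘-resp-≈ assoc refl≈ ⟩
      (inv Y k ∘ (arr f ∘ inv X k)) ∘ inv X k   ≈⟨ ∘-resp-≈ (comm f k) refl≈ ⟩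
      arr f ∘ inv X k                           ∎
    where open HomReasoning

  mkInvHom : ∀ {X Y : InvObj} (f : carrier X ⇒ carrier Y) →
    (∀ k → inv Y k ∘ f ≈ f ∘ inv X k) → InvHom X Y
  mkInvHom {X} {Y} f sq = invHom f (square⇒comm {X} {Y} sq)

  InvCat : Category (o ⊔ ℓ ⊔ e) (ℓ ⊔ e) e
  InvCat = record
    { Obj = InvObj
    ; _⇒_ = InvHom
    ; _≈_ = λ f g → arr f ≈ arr g
    ; ≈-equiv = record { refl = refl≈ ; sym = sym≈ ; trans = trans≈ }
    ; id = λ {X} → mkInvHom id (λ k → trans≈ identityʳ (sym≈ identityˡ))
    ; _∘_ = λ {X} {Y} {Z} g f → mkInvHom (arr g ∘ arr f) (λ k →
        let open HomReasoning in begin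
          inv Z k ∘ (arr g ∘ arr f)   ≈⟨ sym≈ assoc ⟩
          (inv Z k ∘ arr g) ∘ arr f   ≈⟨ ∘-resp-≈ (comm⇒square g k) refl≈ ⟩
          (arr g ∘ inv Y k) ∘ arr f   ≈⟨ assoc ⟩
          arr g ∘ (inv Y k ∘ arr f)   ≈⟨ ∘-resp-≈ refl≈ (comm⇒square f k) ⟩
          arr g ∘ (arr f ∘ inv X k)   ≈⟨ sym≈ assoc ⟩
          (arr g ∘ arr f) ∘ inv X k   ∎)
    ; assoc = assoc
    ; identityˡ = identityˡ
    ; identityʳ = identityʳ
    ; ∘-resp-≈ = ∘-resp-≈
    }

open InvObj
open InvHom

Inv : ∀ {o ℓ e} → SymMonCat o ℓ e → SymMonCat (o ⊔ ℓ ⊔ e) (ℓ ⊔ e) e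
Inv C = record
  { cat = InvCat cat
  ; _⊗₀_ = _⊗'_
  ; _⊗₁_ = λ {X} {Y} {Z} {W} f g → mkInvHom cat (arr f ⊗₁ arr g) ((λ k →
      let open HomReasoning in begin
        (inv Y k ⊗₁ inv W k) ∘ (arr f ⊗₁ arr g)   ≈⟨ sym≈ ⊗-homomorphism ⟩
        (inv Y k ∘ arr f) ⊗₁ (inv W k ∘ arr g)     ≈⟨ ⊗-resp-≈ (comm⇒square cat f k) (comm⇒square cat g k) ⟩
        (arr f ∘ inv X k) ⊗₁ (arr g ∘ inv Z k)     ≈⟨ ⊗-homomorphism ⟩
        (arr f ⊗₁ arr g) ∘ (inv X k ⊗₁ inv Z k)   ∎))
  ; ⊗-identity = ⊗-identity
  ; ⊗-homomorphism = ⊗-homomorphism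
  ; ⊗-resp-≈ = ⊗-resp-≈
  ; unit = unit'
  ; α⇒ = mkInvHom cat α⇒ ((λ k → sym≈ α-natural))
  ; α⇐ = mkInvHom cat α⇐ ((λ k → inverse-square α-isoˡ α-isoʳ α-natural))
  ; α-isoˡ = α-isoˡ
  ; α-isoʳ = α-isoʳ
  ; α-natural = α-natural
  ; lu⇒ = mkInvHom cat lu⇒ ((λ k → sym≈ lu-natural))
  ; lu⇐ = mkInvHom cat lu⇐ ((λ k → inverse-square lu-isoˡ lu-isoʳ lu-natural))
  ; lu-isoˡ = lu-isoˡ
  ; lu-isoʳ = lu-isoʳ
  ; lu-natural = lu-natural
  ; ru⇒ = mkInvHom cat ru⇒ ((λ k → sym≈ ru-natural))
  ; ru⇐ = mkInvHom cat ru⇐ ((λ k → inverse-square ru-isoˡ ru-isoʳ ru-natural))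
  ; ru-isoˡ = ru-isoˡ
  ; ru-isoʳ = ru-isoʳ
  ; ru-natural = ru-natural
  ; σ = mkInvHom cat σ ((λ k → sym≈ σ-natural))
  ; σ-natural = σ-natural
  ; σ-involutive = σ-involutive
  ; pentagon = pentagon
  ; triangle = triangle
  ; hexagon = hexagon
  }
  where
    open SymMonCat C
    _⊗'_ : InvObj cat → InvObj cat → InvObj cat
    X ⊗' Y = invObj (carrier X ⊗₀ carrier Y) (λ k → inv X k ⊗₁ inv Y k) (λ k →
      let open HomReasoning in begin
        (inv X k ⊗₁ inv Y k) ∘ (inv X k ⊗₁ inv Y k)   ≈⟨ sym≈ ⊗-homomorphism ⟩
        (inv X k ∘ inv X k) ⊗₁ (inv Y k ∘ inv Y k)     ≈⟨ ⊗-resp-≈ (inv-invol X k) (inv-invol Y k) ⟩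
        id ⊗₁ id                                       ≈⟨ ⊗-identity ⟩
        id                                             ∎)
    unit' : InvObj cat
    unit' = invObj unit (λ _ → id) (λ _ → identityˡ)

InvFunctor : ∀ {o ℓ e o' ℓ' e'} {C : SymMonCat o ℓ e} {D : SymMonCat o' ℓ' e'} →
  LaxSymMonFunctor C D → LaxSymMonFunctor (Inv C) (Inv D)
InvFunctor {C = C} {D = D} F = record
  { dat = record
    { F₀ = F₀'
    ; F₁ = F₁'
    ; μ = mkInvHom cat μ ((λ k → sym≈ μ-natural))
    ; ε = mkInvHom cat ε ((λ k → trans≈ (∘-resp-≈ identity refl≈)
                                          (trans≈ identityˡ (sym≈ identityʳ))))
    }
  ; identity = identity
  ; homomorphism = homomorphism
  ; F-resp-≈ = F-resp-≈
  ; μ-natural = μ-natural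
  ; associativity = associativity
  ; unitaryˡ = unitaryˡ
  ; unitaryʳ = unitaryʳ
  ; braiding = braiding
  }
  where
    module C = SymMonCat C
    open SymMonCat D
    open LaxSymMonFunctor F
    F₀' : InvObj C.cat → InvObj cat
    F₀' X = invObj (F₀ (carrier X)) (λ k → F₁ (inv X k)) (λ k →
      trans≈ (sym≈ homomorphism) (trans≈ (F-resp-≈ (inv-invol X k)) identity))
    F₁' : ∀ {X Y} → InvHom C.cat X Y → InvHom cat (F₀' X) (F₀' Y)
    F₁' {X} {Y} f = mkInvHom cat (F₁ (arr f)) (λ k →
      trans≈ (sym≈ homomorphism) (trans≈ (F-resp-≈ (comm⇒square C.cat f k)) homomorphism))

-- An adjunction Inv L ⊣ Inv R is the image under Inv of L ⊣ R when its
-- unit and counit have the components of Inv η and Inv ε, i.e. (Inv η)_(A,s) = η_A.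
IsInvImage : ∀ {o ℓ e o' ℓ' e'} {C : SymMonCat o ℓ e} {D : SymMonCat o' ℓ' e'}
  (L : LaxSymMonFunctor C D) (R : LaxSymMonFunctor D C) →
  SymMonAdjunction {C = Inv C} {D = Inv D} (InvFunctor {C = C} {D = D} L) (InvFunctor {C = D} {D = C} R) →
  SymMonAdjunction L R →
  Set (o ⊔ ℓ ⊔ e ⊔ o' ⊔ ℓ' ⊔ e')
IsInvImage {C = C} {D = D} L R adj' adj =
  (∀ (X : InvObj (SymMonCat.cat C)) →
     SymMonCat._≈_ C (arr (η' X)) (η (carrier X))) ×
  (∀ (Y : InvObj (SymMonCat.cat D)) →
     SymMonCat._≈_ D (arr (ε' Y)) (ε (carrier Y)))
  where
    η' = MonoidalNT.η (SymMonAdjunction.unitNT adj')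
    ε' = MonoidalNT.η (SymMonAdjunction.counitNT adj')
    η = MonoidalNT.η (SymMonAdjunction.unitNT adj)
    ε = MonoidalNT.η (SymMonAdjunction.counitNT adj)

-- Inv changes only the objects: a morphism of Inv is an equivariant morphism of the underlying
-- category, and every structure map is the underlying one.  The unit and counit of L ⊣ M are
-- equivariant by naturality, so they lift and inherit the adjunction laws.  Cartesianness lifts
-- because mediating arrows are unique: if h mediates (f, g) into the product of (A, s) and (B, t),
-- then (s ⊗ t) ∘ h and h ∘ u mediate the same pair (f ∘ u, g ∘ u), so h is equivariant.
module Submission where

open import Data.Product using (Σ; _,_; proj₁; proj₂)
open import Defs

open InvObj
open InvHom

module _ {o ℓ e} {C : SymMonCat o ℓ e} where
  open SymMonCat C
  private module I = SymMonCat (Inv C)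

  terminal-arrows-equal : ∀ {T A} → IsTerminal C T → (f g : A ⇒ T) → f ≈ g
  terminal-arrows-equal {A = A} term f g =
    trans≈ (proj₂ (term A) f) (sym≈ (proj₂ (term A) g))

  product-jointly-monic : ∀ {A B P X} {π₁ : P ⇒ A} {π₂ : P ⇒ B} → IsProduct C π₁ π₂ →
    {h h' : X ⇒ P} → π₁ ∘ h ≈ π₁ ∘ h' → π₂ ∘ h ≈ π₂ ∘ h' → h ≈ h'
  product-jointly-monic {π₁ = π₁} {π₂} prod {h} {h'} p q with prod (π₁ ∘ h') (π₂ ∘ h')
  ... | _ , _ , _ , unique = trans≈ (unique h p q) (sym≈ (unique h' refl≈ refl≈))

  Inv-isTerminal : ∀ {T : InvObj cat} → IsTerminal C (carrier T) → IsTerminal (Inv C) T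
  Inv-isTerminal {T} term X =
      mkInvHom cat ! (λ k → terminal-arrows-equal term (inv T k ∘ !) (! ∘ inv X k))
    , λ f → proj₂ (term (carrier X)) (arr f)
    where
      ! : carrier X ⇒ carrier T
      ! = proj₁ (term (carrier X))

  Inv-isProduct : ∀ {A B P : InvObj cat} {π₁ : InvHom cat P A} {π₂ : InvHom cat P B} →
    IsProduct C (arr π₁) (arr π₂) → IsProduct (Inv C) π₁ π₂
  Inv-isProduct {P = P} {π₁} {π₂} prod {X} f g with prod (arr f) (arr g)
  ... | h , π₁∘h , π₂∘h , unique =
    mkInvHom cat h equivariant , π₁∘h , π₂∘h , λ h' → unique (arr h')
    where
      open HomReasoning

      agree-after : ∀ {Y} (π : InvHom cat P Y) (f : InvHom cat X Y) → arr π ∘ h ≈ arr f → ∀ k →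
        arr π ∘ (inv P k ∘ h) ≈ arr π ∘ (h ∘ inv X k)
      agree-after {Y} π f π∘h k = begin
        arr π ∘ (inv P k ∘ h)   ≈⟨ sym≈ assoc ⟩
        (arr π ∘ inv P k) ∘ h   ≈⟨ ∘-resp-≈ (sym≈ (comm⇒square cat π k)) refl≈ ⟩
        (inv Y k ∘ arr π) ∘ h   ≈⟨ assoc ⟩
        inv Y k ∘ (arr π ∘ h)   ≈⟨ ∘-resp-≈ refl≈ π∘h ⟩
        inv Y k ∘ arr f         ≈⟨ comm⇒square cat f k ⟩
        arr f ∘ inv X k         ≈⟨ ∘-resp-≈ (sym≈ π∘h) refl≈ ⟩
        (arr π ∘ h) ∘ inv X k   ≈⟨ assoc ⟩
        arr π ∘ (h ∘ inv X k)   ∎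

      equivariant : ∀ k → inv P k ∘ h ≈ h ∘ inv X k
      equivariant k = product-jointly-monic prod (agree-after π₁ f π₁∘h k) (agree-after π₂ g π₂∘h k)

  Inv-isCartesian : IsCartesian C → IsCartesian (Inv C)
  Inv-isCartesian (term , prod) = Inv-term , λ A B →
    Inv-isProduct {π₁ = I.ru⇒ I.∘ (I.id I.⊗₁ ! B)} {π₂ = I.lu⇒ I.∘ (! A I.⊗₁ I.id)}
      (prod (carrier A) (carrier B))
    where
      Inv-term : IsTerminal (Inv C) I.unit
      Inv-term = Inv-isTerminal term

      ! : ∀ X → X I.⇒ I.unit
      ! X = proj₁ (Inv-term X)

module _ {o ℓ e o' ℓ' e'} {C : SymMonCat o ℓ e} {D : SymMonCat o' ℓ' e'}
         {L : LaxSymMonFunctor C D} {R : LaxSymMonFunctor D C}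
         (adj : SymMonAdjunction L R) where
  private
    module C = SymMonCat C
    module D = SymMonCat D
  open SymMonAdjunction adj

  Inv-adjunction : SymMonAdjunction (InvFunctor {C = C} {D = D} L) (InvFunctor {C = D} {D = C} R)
  Inv-adjunction = record
    { unitNT = record
      { η = λ X → mkInvHom C.cat (η.η (carrier X)) (λ k → C.sym≈ (η.natural (inv X k)))
      ; natural = λ f → η.natural (arr f)
      ; μ-compat = λ X Y → η.μ-compat (carrier X) (carrier Y)
      ; ε-compat = η.ε-compat
      }
    ; counitNT = record
      { η = λ Y → mkInvHom D.cat (ε.η (carrier Y)) (λ k → D.sym≈ (ε.natural (inv Y k)))
      ; natural = λ f → ε.natural (arr f)
      ; μ-compat = λ X Y → ε.μ-compat (carrier X) (carrier Y)
      ; ε-compat = ε.ε-compat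
      }
    ; zig = λ X → zig (carrier X)
    ; zag = λ Y → zag (carrier Y)
    }

  Inv-adjunction-isInvImage : IsInvImage L R Inv-adjunction adj
  Inv-adjunction-isInvImage = (λ X → C.refl≈) , (λ Y → D.refl≈)

mainTheorem3 : ∀ {o ℓ e o' ℓ' e'} {𝓜 : SymMonCat o ℓ e} {𝓛 : SymMonCat o' ℓ' e'}
    (L : LaxSymMonFunctor 𝓜 𝓛) (M : LaxSymMonFunctor 𝓛 𝓜) →
    (adj : LNLAdjunction L M) →
    Σ (LNLAdjunction {C = Inv 𝓜} {D = Inv 𝓛} (InvFunctor {C = 𝓜} {D = 𝓛} L) (InvFunctor {C = 𝓛} {D = 𝓜} M))
    (λ adj' → IsInvImage L M (proj₂ adj') (proj₂ adj))
mainTheorem3 {𝓜 = 𝓜} L M (cartesian , adj) =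
  (Inv-isCartesian {C = 𝓜} cartesian , Inv-adjunction {L = L} {R = M} adj) ,
  Inv-adjunction-isInvImage {L = L} {R = M} adj
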